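{- For every natural number $n$ and all formulae $\psi,\gamma$: if the sequents $\psi\vdash\gamma$, $\psi^2\vdash\gamma$, \ldots, $\psi^n\vdash\gamma$ and $\psi^n,\psi^+\vdash\gamma$ are all derivable in $\mathbf{ACT}$, then $\psi^+\vdash\gamma$ is derivable in $\mathbf{ACT}$.
   Context: Formulae are built from propositional variables and constants $\mathbf{0},\mathbf{1}$ using binary connectives $\cdot$, $\backslash$, $/$, $\vee$, $\wedge$ and unary ${}^*$; $\psi^+$ abbreviates $\psi\cdot\psi^*$, and in an antecedent $\psi^k$ denotes $k$ consecutive copies of $\psi$. A sequent is $\Gamma\vdash\beta$ with $\Gamma$ a finite, possibly empty (denoted $\Lambda$), sequence of formulae. The calculus $\mathbf{MALC}$ has axioms $\alpha\vdash\alpha$, $\Gamma,\mathbf{0},\Delta\vdash\gamma$, $\Lambda\vdash\mathbf{1}$, and rules: from $\Gamma,\Delta\vdash\gamma$ infer $\Gamma,\mathbf{1},\Delta\vdash\gamma$; from $\Pi\vdash\alpha$ and $\Gamma,\beta,\Delta\vdash\gamma$ infer $\Gamma,\Pi,\alpha\backslash\beta,\Delta\vdash\gamma$ and also $\Gamma,\beta/\alpha,\Pi,\Delta\vdash\gamma$; from $\alpha,\Pi\vdash\beta$ infer $\Pi\vdash\alpha\backslash\beta$; from $\Pi,\alpha\vdash\beta$ infer $\Pi\vdash\beta/\alpha$; from $\Gamma,\alpha,\beta,\Delta\vdash\gamma$ infer $\Gamma,\alpha\cdot\beta,\Delta\vdash\gamma$; from $\Gamma\vdash\alpha$ and $\Delta\vdash\beta$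 infer $\Gamma,\Delta\vdash\alpha\cdot\beta$; from $\Gamma,\alpha_i,\Delta\vdash\gamma$ ($i=1,2$) infer $\Gamma,\alpha_1\wedge\alpha_2,\Delta\vdash\gamma$; from $\Pi\vdash\alpha_1$ and $\Pi\vdash\alpha_2$ infer $\Pi\vdash\alpha_1\wedge\alpha_2$; from $\Gamma,\alpha_1,\Delta\vdash\gamma$ and $\Gamma,\alpha_2,\Delta\vdash\gamma$ infer $\Gamma,\alpha_1\vee\alpha_2,\Delta\vdash\gamma$; from $\Pi\vdash\alpha_i$ ($i=1,2$) infer $\Pi\vdash\alpha_1\vee\alpha_2$. Action logic $\mathbf{ACT}$ is $\mathbf{MALC}$ extended with: from $\Lambda\vdash\beta$ and $\alpha,\beta\vdash\beta$ infer $\alpha^*\vdash\beta$; cut (from $\Pi\vdash\alpha$ and $\Gamma,\alpha,\Delta\vdash\gamma$ infer $\Gamma,\Pi,\Delta\vdash\gamma$); the axiom $\Lambda\vdash\alpha^*$; from $\Pi\vdash\alpha$ and $\Delta\vdash\alpha^*$ infer $\Pi,\Delta\vdash\alpha^*$. -}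

module Defs where

open import Data.Nat using (ℕ; _≤_)
open import Data.List using (List; []; _∷_; _++_; [_]; replicate)

infixr 30 _·_
infixr 25 _∖_
infixl 25 _／_
infixr 20 _∨_ _∧_
data Fm : Set where
  var  : ℕ → Fm
  𝟎 𝟏  : Fm
  _·_  : Fm → Fm → Fm
  _∖_  : Fm → Fm → Fm
  _／_  : Fm → Fm → Fm
  _∨_  : Fm → Fm → Fm
  _∧_  : Fm → Fm → Fm
  _*   : Fm → Fm

_⁺ : Fm → Fm
ψ ⁺ = ψ · (ψ *)

Ctx : Set
Ctx = List Fm

infix 2 _⊢_
data _⊢_ : Ctx → Fm → Set where
  ax    : ∀ {α} → [ α ] ⊢ α
  0L    : ∀ {Γ Δ γ} → Γ ++ 𝟎 ∷ Δ ⊢ γ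
  1R    : [] ⊢ 𝟏
  1L    : ∀ {Γ Δ γ} → Γ ++ Δ ⊢ γ → Γ ++ 𝟏 ∷ Δ ⊢ γ
  ∖L    : ∀ {Γ Π Δ α β γ} → Π ⊢ α → Γ ++ β ∷ Δ ⊢ γ →
          Γ ++ Π ++ (α ∖ β) ∷ Δ ⊢ γ
  ／L    : ∀ {Γ Π Δ α β γ} → Π ⊢ α → Γ ++ β ∷ Δ ⊢ γ →
          Γ ++ (β ／ α) ∷ Π ++ Δ ⊢ γ
  ∖R    : ∀ {Π α β} → α ∷ Π ⊢ β → Π ⊢ α ∖ β
  ／R    : ∀ {Π α β} → Π ++ [ α ] ⊢ β → Π ⊢ β ／ α
  ·L    : ∀ {Γ Δ α β γ} → Γ ++ α ∷ β ∷ Δ ⊢ γ → Γ ++ (α · β) ∷ Δ ⊢ γ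
  ·R    : ∀ {Γ Δ α β} → Γ ⊢ α → Δ ⊢ β → Γ ++ Δ ⊢ α · β
  ∧L₁   : ∀ {Γ Δ α₁ α₂ γ} → Γ ++ α₁ ∷ Δ ⊢ γ → Γ ++ (α₁ ∧ α₂) ∷ Δ ⊢ γ
  ∧L₂   : ∀ {Γ Δ α₁ α₂ γ} → Γ ++ α₂ ∷ Δ ⊢ γ → Γ ++ (α₁ ∧ α₂) ∷ Δ ⊢ γ
  ∧R    : ∀ {Π α₁ α₂} → Π ⊢ α₁ → Π ⊢ α₂ → Π ⊢ α₁ ∧ α₂
  ∨L    : ∀ {Γ Δ α₁ α₂ γ} → Γ ++ α₁ ∷ Δ ⊢ γ → Γ ++ α₂ ∷ Δ ⊢ γ →
          Γ ++ (α₁ ∨ α₂) ∷ Δ ⊢ γ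
  ∨R₁   : ∀ {Π α₁ α₂} → Π ⊢ α₁ → Π ⊢ α₁ ∨ α₂
  ∨R₂   : ∀ {Π α₁ α₂} → Π ⊢ α₂ → Π ⊢ α₁ ∨ α₂
  *ind  : ∀ {α β} → [] ⊢ β → α ∷ β ∷ [] ⊢ β → [ α * ] ⊢ β
  cut   : ∀ {Γ Π Δ α γ} → Π ⊢ α → Γ ++ α ∷ Δ ⊢ γ → Γ ++ Π ++ Δ ⊢ γ
  *R₀   : ∀ {α} → [] ⊢ α *
  *R    : ∀ {Π Δ α} → Π ⊢ α → Δ ⊢ α * → Π ++ Δ ⊢ α *

_^_ : Fm → ℕ → Ctx
ψ ^ k = replicate k ψ

module Submission where

-- By star induction ψ* ⊢ 𝟏 ∨ ψ⁺, so ψ⁺ ⊢ ψ ∨ ψ · ψ⁺; unrolling this n times gives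
-- ψ⁺ ⊢ ψ ∨ ψ · (ψ ∨ ψ · ( … (ψ ∨ ψ · ψ⁺))). Decomposing that succedent on the left
-- leaves exactly the antecedents ψ¹, …, ψⁿ and ψⁿ, ψ⁺, which are the hypotheses;
-- one cut finishes the proof.

open import Defs
open import Data.Nat using (ℕ; zero; suc; _≤_; _<_; s≤s; z≤n)
open import Data.List using ([]; _∷_; _++_; [_])
open import Data.List.Properties using (++-assoc)
open import Relation.Binary.PropositionalEquality using (subst; sym)

unroll : Fm → ℕ → Fm
unroll ψ zero    = ψ ⁺
unroll ψ (suc m) = ψ ∨ ψ · unroll ψ m

*⊢𝟏∨⁺ : (ψ : Fm) → [ (ψ *) ] ⊢ 𝟏 ∨ (ψ ⁺)
*⊢𝟏∨⁺ ψ = *ind (∨R₁ 1R) (∨L {Γ = [ ψ ]} unit plus)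
  where
  unit : ψ ∷ 𝟏 ∷ [] ⊢ 𝟏 ∨ (ψ ⁺)
  unit = 1L {Γ = [ ψ ]} (∨R₂ (·R {Γ = [ ψ ]} ax *R₀))
  plus : ψ ∷ (ψ ⁺) ∷ [] ⊢ 𝟏 ∨ (ψ ⁺)
  plus = ·L {Γ = [ ψ ]} (∨R₂ (·R {Γ = [ ψ ]} ax (*R {Π = [ ψ ]} ax ax)))

⁺⊢∨·⁺ : (ψ : Fm) → [ (ψ ⁺) ] ⊢ ψ ∨ ψ · (ψ ⁺)
⁺⊢∨·⁺ ψ = ·L {Γ = []} (cut {Γ = [ ψ ]} {Δ = []} (*⊢𝟏∨⁺ ψ) (∨L {Γ = [ ψ ]} unit plus))
  where
  unit : ψ ∷ 𝟏 ∷ [] ⊢ ψ ∨ ψ · (ψ ⁺)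
  unit = 1L {Γ = [ ψ ]} (∨R₁ ax)
  plus : ψ ∷ (ψ ⁺) ∷ [] ⊢ ψ ∨ ψ · (ψ ⁺)
  plus = ∨R₂ (·R {Γ = [ ψ ]} ax ax)

∨·-monoʳ : (ψ : Fm) {α β : Fm} → [ α ] ⊢ β → [ ψ ∨ ψ · α ] ⊢ ψ ∨ ψ · β
∨·-monoʳ ψ α⊢β = ∨L {Γ = []} (∨R₁ ax) (·L {Γ = []} (∨R₂ (·R {Γ = [ ψ ]} ax α⊢β)))

⁺⊢unroll : (ψ : Fm) (m : ℕ) → [ (ψ ⁺) ] ⊢ unroll ψ m
⁺⊢unroll ψ zero    = ax
⁺⊢unroll ψ (suc m) = cut {Γ = []} {Δ = []} (⁺⊢∨·⁺ ψ) (∨·-monoʳ ψ (⁺⊢unroll ψ m))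

unroll-elim : (ψ γ : Fm) (m : ℕ) (Γ : Ctx) →
  ((i : ℕ) → i < m → Γ ++ ψ ^ suc i ⊢ γ) →
  Γ ++ ψ ^ m ++ [ (ψ ⁺) ] ⊢ γ →
  Γ ++ [ unroll ψ m ] ⊢ γ
unroll-elim ψ γ zero    Γ H G = G
unroll-elim ψ γ (suc m) Γ H G =
  ∨L {Γ = Γ} (H 0 (s≤s z≤n)) (·L {Γ = Γ} (reassoc (unroll-elim ψ γ m (Γ ++ [ ψ ]) H′ G′)))
  where
  reassoc : ∀ {Δ} → (Γ ++ [ ψ ]) ++ Δ ⊢ γ → Γ ++ ψ ∷ Δ ⊢ γ
  reassoc {Δ} = subst (_⊢ γ) (++-assoc Γ [ ψ ] Δ)
  unassoc : ∀ {Δ} → Γ ++ ψ ∷ Δ ⊢ γ → (Γ ++ [ ψ ]) ++ Δ ⊢ γ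
  unassoc {Δ} = subst (_⊢ γ) (sym (++-assoc Γ [ ψ ] Δ))
  H′ : (i : ℕ) → i < m → (Γ ++ [ ψ ]) ++ ψ ^ suc i ⊢ γ
  H′ i i<m = unassoc (H (suc i) (s≤s i<m))
  G′ : (Γ ++ [ ψ ]) ++ ψ ^ m ++ [ (ψ ⁺) ] ⊢ γ
  G′ = unassoc G

lemma3 : (n : ℕ) (ψ γ : Fm) →
    ((k : ℕ) → 1 ≤ k → k ≤ n → ψ ^ k ⊢ γ) →
    (ψ ^ n) ++ [ (ψ ⁺) ] ⊢ γ →
    [ (ψ ⁺) ] ⊢ γ
lemma3 n ψ γ H G =
  cut {Γ = []} {Δ = []} (⁺⊢unroll ψ n) (unroll-elim ψ γ n [] (λ i i<n → H (suc i) (s≤s z≤n) i<n) G)
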